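{- Fix an integer $r\ge3$ and write $c_i=c_i^{[r]}$. Let $\omega,\xi,a,b$ be integers such that $b-a>0$, $\omega c_a-\xi c_{a-1}>0$ and $\omega c_b-\xi c_{b-1}>0$. Then $(\omega c_a-\xi c_{a-1})(\omega c_b-\xi c_{b-1})>c_{b-a-1}$.
   Context: For a positive integer $r$, the sequence $(c_n^{[r]})_{n\in\mathbb{Z}}$ is defined by $c_1^{[r]}=0$, $c_2^{[r]}=1$ and the recurrence $c_n^{[r]}=rc_{n-1}^{[r]}-c_{n-2}^{[r]}$ for all $n\in\mathbb{Z}$. -}

module Defs where

open import Data.Nat using (ℕ; zero; suc)
open import Data.Integer using (ℤ; +_; -[1+_]; _+_; _-_; _*_; -_)
open import Data.Product using (_×_; _,_; proj₁)

-- fwd r k = (c_{k+1}, c_{k+2}), starting from (c_1, c_2) = (0, 1),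
-- stepping with c_{n} = r c_{n-1} - c_{n-2}.
fwd : ℤ → ℕ → ℤ × ℤ
fwd r zero = (+ 0 , + 1)
fwd r (suc k) with fwd r k
... | (x , y) = (y , r * y - x)

-- bwd r k = (c_{1-k}, c_{2-k}), stepping backwards with
-- c_{n-2} = r c_{n-1} - c_n.
bwd : ℤ → ℕ → ℤ × ℤ
bwd r zero = (+ 0 , + 1)
bwd r (suc k) with bwd r k
... | (x , y) = (r * x - y , x)

c : ℤ → ℤ → ℤ
c r (+ zero)    = proj₁ (bwd r 1)
c r (+ (suc n)) = proj₁ (fwd r n)
c r -[1+ n ]    = proj₁ (bwd r (suc (suc n)))

-- Write b = a + k + 1 and X j = x (a + j) with x n = ω c_n - ξ c_(n-1), so the claim is
-- c_k < X₀ X (k+1).  X solves X (j+2) = r X (j+1) - X j, as does C j = c_j, and the form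
-- Q = X₀² - r X₀ X₁ + X₁² is conserved along X.  If Q < 0, consecutive terms have the same sign, so
-- X is positive and d'Ocagne's identity X₀ X (k+1) = X₁ X k - Q c_(k+1) gives X₀ X (k+1) ≥ c_(k+1).
-- If Q ≥ 0, either X₀ ≤ X₁, or X is strictly decreasing and X (k+1) ≤ X k.  In the first case
-- X (k+1) = X₁ c_(k+2) - X₀ c_(k+1); in the second, by constancy of the Casoratian of X and the
-- shifted c, X₀ = X k c_(k+2) - X (k+1) c_(k+1).  Either way the product is at least
-- c_(k+2) - c_(k+1), which exceeds c_k as soon as r ≥ 3.

module Submission where

open import Defs
open import Data.Integer using (ℤ; +_; _+_; _-_; _*_; _<_; _≤_)
open import Data.Integer using (-[1+_]; -_; 0ℤ; 1ℤ; +≤+; +<+; -<+; _≤?_; _<?_)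
import Data.Integer.Properties as ℤ
open import Data.Integer.Tactic.RingSolver using (solve; solve-∀)
open import Data.List using (_∷_; [])
open import Data.Nat using (ℕ; zero; suc; z≤n)
import Data.Nat.Properties as ℕ
open import Data.Product using (_×_; _,_; proj₁; proj₂; ∃)
open import Function using (_∘_)
open import Relation.Binary.PropositionalEquality
open import Relation.Nullary using (yes; no; contradiction)

private
  variable
    i j : ℤ

-- Inequalities below are proved by writing the relevant difference as a sum of products of
-- quantities already known to be nonnegative, the identity being checked by the ring solver.

+-nonNeg : 0ℤ ≤ i → 0ℤ ≤ j → 0ℤ ≤ i + j
+-nonNeg = ℤ.+-mono-≤

*-nonNeg : 0ℤ ≤ i → 0ℤ ≤ j → 0ℤ ≤ i * j
*-nonNeg {+ m} {+ n} _ _ = subst (0ℤ ≤_) (ℤ.pos-* m n) (+≤+ z≤n)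

i<j⇒0≤j-i-1 : ∀ {i j} → i < j → 0ℤ ≤ j - i - 1ℤ
i<j⇒0≤j-i-1 {i} {j} i<j = subst (0ℤ ≤_) (shift i j) (ℤ.i≤j⇒0≤j-i (ℤ.i<j⇒suc[i]≤j i<j))
  where shift : ∀ i j → j - (1ℤ + i) ≡ j - i - 1ℤ
        shift = solve-∀

0≤j-i-1⇒i<j : ∀ {i j} → 0ℤ ≤ j - i - 1ℤ → i < j
0≤j-i-1⇒i<j {i} {j} 0≤j-i-1 = ℤ.suc[i]≤j⇒i<j (ℤ.0≤i-j⇒j≤i (subst (0ℤ ≤_) (shift i j) 0≤j-i-1))
  where shift : ∀ i j → j - i - 1ℤ ≡ j - (1ℤ + i)
        shift = solve-∀

module _ (r : ℤ) where

  IsSolution : (ℕ → ℤ) → Set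
  IsSolution X = ∀ n → X (suc (suc n)) ≡ r * X (suc n) - X n

  private
    variable
      X Y Z : ℕ → ℤ

  form : ℤ → ℤ → ℤ
  form p q = p * p - r * p * q + q * q

  conserved : (f : ℕ → ℤ) → (∀ n → f (suc n) ≡ f n) → ∀ n → f n ≡ f 0
  conserved f step zero    = refl
  conserved f step (suc n) = trans (step n) (conserved f step n)

  form-conserved : IsSolution X → ∀ n → form (X n) (X (suc n)) ≡ form (X 0) (X 1)
  form-conserved {X} X-sol = conserved (λ n → form (X n) (X (suc n))) step
    where
      form-step : ∀ p q → q * q - r * q * (r * q - p) + (r * q - p) * (r * q - p)
                          ≡ p * p - r * p * q + q * q
      form-step p q = solve (r ∷ p ∷ q ∷ [])
      step : ∀ n → form (X (suc n)) (X (suc (suc n))) ≡ form (X n) (X (suc n))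
      step n rewrite X-sol n = form-step (X n) (X (suc n))

  casoratian-conserved : IsSolution X → IsSolution Y →
                         ∀ n → X n * Y (suc n) - X (suc n) * Y n ≡ X 0 * Y 1 - X 1 * Y 0
  casoratian-conserved {X} {Y} X-sol Y-sol =
    conserved (λ n → X n * Y (suc n) - X (suc n) * Y n) step
    where
      casoratian-step : ∀ x₀ x₁ y₀ y₁ → x₁ * (r * y₁ - y₀) - (r * x₁ - x₀) * y₁ ≡ x₀ * y₁ - x₁ * y₀
      casoratian-step x₀ x₁ y₀ y₁ = solve (r ∷ x₀ ∷ x₁ ∷ y₀ ∷ y₁ ∷ [])
      step : ∀ n → X (suc n) * Y (suc (suc n)) - X (suc (suc n)) * Y (suc n)
                   ≡ X n * Y (suc n) - X (suc n) * Y n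
      step n rewrite X-sol n | Y-sol n = casoratian-step (X n) (X (suc n)) (Y n) (Y (suc n))

  solutions-agree : IsSolution X → IsSolution Y → X 0 ≡ Y 0 → X 1 ≡ Y 1 → ∀ n → X n ≡ Y n
  solutions-agree {X} {Y} X-sol Y-sol e₀ e₁ n = proj₁ (consecutive n)
    where
      consecutive : ∀ n → X n ≡ Y n × X (suc n) ≡ Y (suc n)
      consecutive zero    = e₀ , e₁
      consecutive (suc n) with consecutive n
      ... | eₙ , eₙ₊₁ =
        eₙ₊₁ , trans (X-sol n) (trans (cong₂ (λ s t → r * s - t) eₙ₊₁ eₙ) (sym (Y-sol n)))

  lincomb-isSolution : ∀ p q → IsSolution Y → IsSolution Z → IsSolution (λ n → p * Y n - q * Z n)
  lincomb-isSolution {Y} {Z} p q Y-sol Z-sol n rewrite Y-sol n | Z-sol n =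
    lincomb-step (Y n) (Y (suc n)) (Z n) (Z (suc n))
    where
      lincomb-step : ∀ y₀ y₁ z₀ z₁ → p * (r * y₁ - y₀) - q * (r * z₁ - z₀)
                                     ≡ r * (p * y₁ - q * z₁) - (p * y₀ - q * z₀)
      lincomb-step y₀ y₁ z₀ z₁ = solve (r ∷ p ∷ q ∷ y₀ ∷ y₁ ∷ z₀ ∷ z₁ ∷ [])

  C : ℕ → ℤ
  C n = c r (+ n)

  C-isSolution : IsSolution C
  C-isSolution zero    = C₂
    where C₂ : + 1 ≡ r * + 0 - (r * + 0 - + 1)
          C₂ = solve (r ∷ [])
  C-isSolution (suc n) = refl

  C₀ : C 0 ≡ - 1ℤ
  C₀ = r*0-1≡-1
    where r*0-1≡-1 : r * + 0 - + 1 ≡ - 1ℤ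
          r*0-1≡-1 = solve (r ∷ [])

  private
    v≡ru-[ru-v] : ∀ u v → v ≡ r * u - (r * u - v)
    v≡ru-[ru-v] u v = solve (r ∷ u ∷ v ∷ [])

  IsSolutionℤ : (ℤ → ℤ) → Set
  IsSolutionℤ x = ∀ n → x (n + 1ℤ) ≡ r * x n - x (n - 1ℤ)

  c-isSolutionℤ : IsSolutionℤ (c r)
  c-isSolutionℤ (+ zero)      = v≡ru-[ru-v] (c r (+ 0)) (+ 0)
  c-isSolutionℤ (+ suc m)     = trans (cong (c r ∘ +_ ∘ suc) (ℕ.+-comm m 1)) (C-isSolution m)
  c-isSolutionℤ -[1+ zero ]   = v≡ru-[ru-v] (c r -[1+ 0 ]) (c r (+ 0))
  c-isSolutionℤ -[1+ suc j ]  =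
    trans (v≡ru-[ru-v] (c r -[1+ suc j ]) (c r -[1+ j ]))
          (cong (λ m → r * c r -[1+ suc j ] - c r -[1+ suc m ]) (sym (ℕ.+-identityʳ (suc j))))

  forward-isSolution : ∀ {x} → IsSolutionℤ x → ∀ a → IsSolution (λ k → x (a + + k))
  forward-isSolution {x} x-sol a k =
    trans (cong x (next a (+ k)))
          (trans (x-sol (a + + suc k)) (cong (λ m → r * x (a + + suc k) - x m) (previous a (+ k))))
    where
      next : ∀ a i → a + (1ℤ + (1ℤ + i)) ≡ a + (1ℤ + i) + 1ℤ
      next = solve-∀
      previous : ∀ a i → a + (1ℤ + i) - 1ℤ ≡ a + i
      previous = solve-∀

  representation : IsSolution X → ∀ n → X n ≡ X 1 * C (suc n) - X 0 * C n
  representation {X} X-sol =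
    solutions-agree X-sol (lincomb-isSolution (X 1) (X 0) (C-isSolution ∘ suc) C-isSolution)
      (sym R₀) (sym (value₁ (X 0) (X 1)))
    where
      value₀ : ∀ x₀ x₁ → x₁ * + 0 - x₀ * - 1ℤ ≡ x₀
      value₀ = solve-∀
      value₁ : ∀ x₀ x₁ → x₁ * + 1 - x₀ * + 0 ≡ x₁
      value₁ = solve-∀
      R₀ : X 1 * C 1 - X 0 * C 0 ≡ X 0
      R₀ rewrite C₀ = value₀ (X 0) (X 1)

  representation-backward : IsSolution X → ∀ n → X 0 ≡ X n * C (suc (suc n)) - X (suc n) * C (suc n)
  representation-backward {X} X-sol n =
    sym (trans (casoratian-conserved X-sol (C-isSolution ∘ suc) n) (value₀ (X 0) (X 1)))
    where
      value₀ : ∀ x₀ x₁ → x₀ * + 1 - x₁ * + 0 ≡ x₀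
      value₀ = solve-∀

  d'Ocagne : IsSolution X → ∀ k → X 0 * X (suc k) ≡ X 1 * X k - form (X 0) (X 1) * C (suc k)
  d'Ocagne {X} X-sol k
    rewrite representation X-sol (suc k) | representation X-sol k | C-isSolution k =
    identity (X 0) (X 1) (C k) (C (suc k))
    where
      identity : ∀ x₀ x₁ c₀ c₁ → x₀ * (x₁ * (r * c₁ - c₀) - x₀ * c₁)
                                 ≡ x₁ * (x₁ * c₁ - x₀ * c₀) - (x₀ * x₀ - r * x₀ * x₁ + x₁ * x₁) * c₁
      identity x₀ x₁ c₀ c₁ = solve (r ∷ x₀ ∷ x₁ ∷ c₀ ∷ c₁ ∷ [])

  module _ (r≥2 : + 2 ≤ r) where

    private
      0≤r-2 : 0ℤ ≤ r - + 2
      0≤r-2 = ℤ.i≤j⇒0≤j-i r≥2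

    increasing : IsSolution X → 0ℤ ≤ X 1 → X 0 < X 1 → ∀ n → 0ℤ ≤ X (suc n) × X n < X (suc n)
    increasing X-sol 0≤X₁ X₀<X₁ zero    = 0≤X₁ , X₀<X₁
    increasing {X} X-sol 0≤X₁ X₀<X₁ (suc n) with increasing X-sol 0≤X₁ X₀<X₁ n
    ... | 0≤Xₙ₊₁ , Xₙ<Xₙ₊₁ = ℤ.≤-trans 0≤Xₙ₊₁ (ℤ.<⇒≤ Xₙ₊₁<Xₙ₊₂) , Xₙ₊₁<Xₙ₊₂
      where
        identity : ∀ x₀ x₁ → (r - + 2) * x₁ + (x₁ - x₀ - 1ℤ) ≡ r * x₁ - x₀ - x₁ - 1ℤ
        identity x₀ x₁ = solve (r ∷ x₀ ∷ x₁ ∷ [])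
        Xₙ₊₁<Xₙ₊₂ : X (suc n) < X (suc (suc n))
        Xₙ₊₁<Xₙ₊₂ rewrite X-sol n = 0≤j-i-1⇒i<j (subst (0ℤ ≤_) (identity (X n) (X (suc n)))
          (+-nonNeg (*-nonNeg 0≤r-2 0≤Xₙ₊₁) (i<j⇒0≤j-i-1 Xₙ<Xₙ₊₁)))

    C-increasing : ∀ n → 0ℤ ≤ C (suc n) × C n < C (suc n)
    C-increasing = increasing C-isSolution (+≤+ z≤n) (subst (_< + 0) (sym C₀) -<+)

    form-negative⇒same-sign : ∀ {p q} → form p q < 0ℤ → 0ℤ < p → 0ℤ < q
    form-negative⇒same-sign {p} {q} Q<0 0<p with 0ℤ <? q
    ... | yes 0<q = 0<q
    ... | no  0≮q = contradiction Q<0 (ℤ.≤⇒≯ (subst (0ℤ ≤_) (identity p q)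
            (+-nonNeg (*-nonNeg 0≤p-q 0≤p-q) (*-nonNeg 0≤r-2 (*-nonNeg (ℤ.<⇒≤ 0<p) 0≤-q)))))
      where
        q≤0 : q ≤ 0ℤ
        q≤0 = ℤ.≮⇒≥ 0≮q
        0≤p-q : 0ℤ ≤ p - q
        0≤p-q = ℤ.i≤j⇒0≤j-i (ℤ.≤-trans q≤0 (ℤ.<⇒≤ 0<p))
        0≤-q : 0ℤ ≤ 0ℤ - q
        0≤-q = ℤ.i≤j⇒0≤j-i q≤0
        identity : ∀ p q → (p - q) * (p - q) + (r - + 2) * (p * (0ℤ - q)) ≡ p * p - r * p * q + q * q
        identity p q = solve (r ∷ p ∷ q ∷ [])

    form-negative⇒positive : IsSolution X → form (X 0) (X 1) < 0ℤ → 0ℤ < X 0 → ∀ n → 0ℤ < X n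
    form-negative⇒positive X-sol Q<0 0<X₀ zero    = 0<X₀
    form-negative⇒positive X-sol Q<0 0<X₀ (suc n) =
      form-negative⇒same-sign (subst (_< 0ℤ) (sym (form-conserved X-sol n)) Q<0)
        (form-negative⇒positive X-sol Q<0 0<X₀ n)

    form-nonNegative⇒decreasing-step : ∀ {p q} → 0ℤ ≤ form p q → q < p → r * q - p < q
    form-nonNegative⇒decreasing-step {p} {q} 0≤Q q<p with q ≤? 0ℤ
    ... | yes q≤0 = 0≤j-i-1⇒i<j (subst (0ℤ ≤_) (identity p q)
                      (+-nonNeg (i<j⇒0≤j-i-1 q<p) (*-nonNeg 0≤r-2 (ℤ.i≤j⇒0≤j-i q≤0))))
      where
        identity : ∀ p q → (p - q - 1ℤ) + (r - + 2) * (0ℤ - q) ≡ q - (r * q - p) - 1ℤ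
        identity p q = solve (r ∷ p ∷ q ∷ [])
    ... | no q≰0 with r * q - p <? q
    ...   | yes step = step
    ...   | no  ¬step = contradiction 0≤Q (ℤ.<⇒≱ (0≤j-i-1⇒i<j (subst (0ℤ ≤_) (identity p q)
              (+-nonNeg (+-nonNeg (+-nonNeg (*-nonNeg 0≤p 0≤[r-1]q-p) (*-nonNeg 0≤q-1 0≤p-q-1)) 0≤q-1)
                        0≤p-q-1))))
      where
        0<q : 0ℤ < q
        0<q = ℤ.≰⇒> q≰0
        0≤p : 0ℤ ≤ p
        0≤p = ℤ.<⇒≤ (ℤ.<-trans 0<q q<p)
        0≤q-1 : 0ℤ ≤ q - 0ℤ - 1ℤ
        0≤q-1 = i<j⇒0≤j-i-1 0<q
        0≤p-q-1 : 0ℤ ≤ p - q - 1ℤ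
        0≤p-q-1 = i<j⇒0≤j-i-1 q<p
        0≤[r-1]q-p : 0ℤ ≤ r * q - p - q
        0≤[r-1]q-p = ℤ.i≤j⇒0≤j-i (ℤ.≮⇒≥ ¬step)
        -- if q > 0 and r q - p ≥ q then form p q < 0
        identity : ∀ p q → p * (r * q - p - q) + (q - 0ℤ - 1ℤ) * (p - q - 1ℤ)
                             + (q - 0ℤ - 1ℤ) + (p - q - 1ℤ)
                           ≡ 0ℤ - (p * p - r * p * q + q * q) - 1ℤ
        identity p q = solve (r ∷ p ∷ q ∷ [])

    form-nonNegative⇒decreasing : IsSolution X → 0ℤ ≤ form (X 0) (X 1) → X 1 < X 0 → ∀ n → X (suc n) < X n
    form-nonNegative⇒decreasing X-sol 0≤Q X₁<X₀ zero    = X₁<X₀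
    form-nonNegative⇒decreasing {X} X-sol 0≤Q X₁<X₀ (suc n) rewrite X-sol n =
      form-nonNegative⇒decreasing-step (subst (0ℤ ≤_) (sym (form-conserved X-sol n)) 0≤Q)
        (form-nonNegative⇒decreasing X-sol 0≤Q X₁<X₀ n)

  module _ (r≥3 : + 3 ≤ r) where

    private
      r≥2 : + 2 ≤ r
      r≥2 = ℤ.≤-trans (+≤+ (ℕ.n≤1+n 2)) r≥3

    C[n]+C[1+n]<C[2+n] : ∀ n → C n + C (suc n) < C (suc (suc n))
    C[n]+C[1+n]<C[2+n] n rewrite C-isSolution n =
      0≤j-i-1⇒i<j (subst (0ℤ ≤_) (identity (C n) (C (suc n)))
        (+-nonNeg (+-nonNeg (*-nonNeg (ℤ.i≤j⇒0≤j-i r≥3) 0≤C₁) (+-nonNeg 0≤C₁-C₀-1 0≤C₁-C₀-1))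
                  (+≤+ z≤n)))
      where
        0≤C₁ : 0ℤ ≤ C (suc n)
        0≤C₁ = proj₁ (C-increasing r≥2 n)
        0≤C₁-C₀-1 : 0ℤ ≤ C (suc n) - C n - 1ℤ
        0≤C₁-C₀-1 = i<j⇒0≤j-i-1 (proj₂ (C-increasing r≥2 n))
        identity : ∀ c₀ c₁ → (r - + 3) * c₁ + ((c₁ - c₀ - 1ℤ) + (c₁ - c₀ - 1ℤ)) + 1ℤ
                             ≡ r * c₁ - c₀ - (c₀ + c₁) - 1ℤ
        identity c₀ c₁ = solve (r ∷ c₀ ∷ c₁ ∷ [])

    growth-bound : ∀ {u v} → 0ℤ < u → u ≤ v → ∀ k → C k < u * (v * C (suc (suc k)) - u * C (suc k))
    growth-bound {u} {v} 0<u u≤v k =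
      0≤j-i-1⇒i<j (subst (0ℤ ≤_) (identity u v (C k) (C (suc k)) (C (suc (suc k))))
        (+-nonNeg (+-nonNeg (*-nonNeg (*-nonNeg (ℤ.<⇒≤ 0<u) (ℤ.i≤j⇒0≤j-i u≤v)) 0≤C₂)
                            (*-nonNeg (*-nonNeg 0≤u-1 0≤u+1) 0≤C₂-C₁))
                  0≤C₂-C₁-C₀-1))
      where
        0≤C₂ : 0ℤ ≤ C (suc (suc k))
        0≤C₂ = proj₁ (C-increasing r≥2 (suc k))
        0≤C₂-C₁ : 0ℤ ≤ C (suc (suc k)) - C (suc k)
        0≤C₂-C₁ = ℤ.i≤j⇒0≤j-i (ℤ.<⇒≤ (proj₂ (C-increasing r≥2 (suc k))))
        0≤C₂-C₁-C₀-1 : 0ℤ ≤ C (suc (suc k)) - (C k + C (suc k)) - 1ℤ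
        0≤C₂-C₁-C₀-1 = i<j⇒0≤j-i-1 (C[n]+C[1+n]<C[2+n] k)
        0≤u-1 : 0ℤ ≤ u - 0ℤ - 1ℤ
        0≤u-1 = i<j⇒0≤j-i-1 0<u
        0≤u+1 : 0ℤ ≤ u + 1ℤ
        0≤u+1 = +-nonNeg (ℤ.<⇒≤ 0<u) (+≤+ z≤n)
        identity : ∀ u v c₀ c₁ c₂ → u * (v - u) * c₂ + (u - 0ℤ - 1ℤ) * (u + 1ℤ) * (c₂ - c₁)
                                      + (c₂ - (c₀ + c₁) - 1ℤ)
                                    ≡ u * (v * c₂ - u * c₁) - c₀ - 1ℤ
        identity = solve-∀

    form-negative-bound : IsSolution X → form (X 0) (X 1) < 0ℤ → 0ℤ < X 0 → ∀ k → C k < X 0 * X (suc k)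
    form-negative-bound {X} X-sol Q<0 0<X₀ k rewrite d'Ocagne X-sol k =
      0≤j-i-1⇒i<j (subst (0ℤ ≤_) (identity (X 1) (X k) (form (X 0) (X 1)) (C k) (C (suc k)))
        (+-nonNeg (+-nonNeg (*-nonNeg (positive 1) (positive k)) (*-nonNeg (i<j⇒0≤j-i-1 Q<0) 0≤C₁))
                  (i<j⇒0≤j-i-1 (proj₂ (C-increasing r≥2 k)))))
      where
        positive : ∀ n → 0ℤ ≤ X n
        positive n = ℤ.<⇒≤ (form-negative⇒positive r≥2 X-sol Q<0 0<X₀ n)
        0≤C₁ : 0ℤ ≤ C (suc k)
        0≤C₁ = proj₁ (C-increasing r≥2 k)
        identity : ∀ x₁ xₖ Q c₀ c₁ → x₁ * xₖ + (0ℤ - Q - 1ℤ) * c₁ + (c₁ - c₀ - 1ℤ)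
                                    ≡ x₁ * xₖ - Q * c₁ - c₀ - 1ℤ
        identity = solve-∀

    product-bound : IsSolution X → 0ℤ < X 0 → ∀ k → 0ℤ < X (suc k) → C k < X 0 * X (suc k)
    product-bound {X} X-sol 0<X₀ k 0<Xₖ₊₁ with form (X 0) (X 1) <? 0ℤ | X 0 ≤? X 1
    ... | yes Q<0 | _         = form-negative-bound X-sol Q<0 0<X₀ k
    ... | no  Q≮0 | yes X₀≤X₁ =
      subst (C k <_) (cong (X 0 *_) (sym (representation X-sol (suc k)))) (growth-bound 0<X₀ X₀≤X₁ k)
    ... | no  Q≮0 | no  X₀≰X₁ =
      subst (C k <_) (trans (cong (X (suc k) *_) (sym (representation-backward X-sol k)))
                            (ℤ.*-comm (X (suc k)) (X 0)))
        (growth-bound 0<Xₖ₊₁ Xₖ₊₁≤Xₖ k)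
      where
        Xₖ₊₁≤Xₖ : X (suc k) ≤ X k
        Xₖ₊₁≤Xₖ = ℤ.<⇒≤ (form-nonNegative⇒decreasing r≥2 X-sol (ℤ.≮⇒≥ Q≮0) (ℤ.≰⇒> X₀≰X₁) k)

positive⇒suc : ∀ {i} → 0ℤ < i → ∃ λ k → i ≡ + suc k
positive⇒suc {+ suc k} _         = k , refl
positive⇒suc {+ zero}  (+<+ ())

lemma5p9 : (r : ℤ) → + 3 ≤ r → (ω ξ a b : ℤ) → + 0 < b - a → + 0 < ω * c r a - ξ * c r (a - + 1) → + 0 < ω * c r b - ξ * c r (b - + 1) → c r (b - a - + 1) < (ω * c r a - ξ * c r (a - + 1)) * (ω * c r b - ξ * c r (b - + 1))
lemma5p9 r r≥3 ω ξ a b 0<b-a 0<xa 0<xb with positive⇒suc 0<b-a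
... | k , b-a≡1+k =
  subst₂ _<_ (cong (λ d → c r (d - 1ℤ)) (sym b-a≡1+k)) (cong₂ _*_ X₀≡xa Xₖ₊₁≡xb)
    (product-bound r r≥3 X-isSolution (subst (0ℤ <_) (sym X₀≡xa) 0<xa)
                   k (subst (0ℤ <_) (sym Xₖ₊₁≡xb) 0<xb))
  where
    X : ℕ → ℤ
    X j = ω * c r (a + + j) - ξ * c r (a - 1ℤ + + j)
    X-isSolution : IsSolution r X
    X-isSolution = lincomb-isSolution r ω ξ (forward-isSolution r (c-isSolutionℤ r) a)
                                            (forward-isSolution r (c-isSolutionℤ r) (a - 1ℤ))
    X-at : ∀ j {m} → a + + j ≡ m → X j ≡ ω * c r m - ξ * c r (m - 1ℤ)
    X-at j refl = cong (λ m → ω * c r (a + + j) - ξ * c r m) (shift a (+ j))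
      where shift : ∀ a i → a - 1ℤ + i ≡ a + i - 1ℤ
            shift = solve-∀
    X₀≡xa : X 0 ≡ ω * c r a - ξ * c r (a - 1ℤ)
    X₀≡xa = X-at 0 (ℤ.+-identityʳ a)
    Xₖ₊₁≡xb : X (suc k) ≡ ω * c r b - ξ * c r (b - 1ℤ)
    Xₖ₊₁≡xb = X-at (suc k) (trans (cong (λ d → a + d) (sym b-a≡1+k)) (a+[b-a]≡b a b))
      where a+[b-a]≡b : ∀ a b → a + (b - a) ≡ b
            a+[b-a]≡b = solve-∀
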